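{- For $k\in\{3,4\}$ and every integer $n\geq N(k)$, there exists a pseudo $k$-regular graph on $n$ vertices.
   Context: All graphs are finite, simple and without isolated vertices. For a vertex $i$, $d_i$ is its degree and $m_i=d_i^{ -1}\sum_{j:\, ji\in E(G)} d_j$ is its average $2$-degree. A graph is $k$-harmonic if $m_i=k$ for all vertices $i$; it is pseudo $k$-regular if it is $k$-harmonic but not $k$-regular. $N(k)$ denotes the minimum number of vertices of a pseudo $k$-regular graph. -}

module Defs where

open import Data.Nat using (ℕ; _+_; _*_; _≤_; _>_)
open import Data.Bool using (Bool; true; false; if_then_else_)
open import Data.Fin using (Fin)
open import Data.Vec.Functional using (foldr)
open import Data.Product using (Σ; ∃; _×_)
open import Relation.Binary.PropositionalEquality using (_≡_)
open import Relation.Nullary using (¬_)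

sumFin : (n : ℕ) → (Fin n → ℕ) → ℕ
sumFin n f = foldr _+_ 0 f

record Graph (n : ℕ) : Set where
  field
    adj       : Fin n → Fin n → Bool
    symmetric : ∀ i j → adj i j ≡ adj j i
    loopless  : ∀ i → adj i i ≡ false

open Graph public

deg : {n : ℕ} → Graph n → Fin n → ℕ
deg {n} G i = sumFin n (λ j → if adj G i j then 1 else 0)

-- Σ_{j ~ i} d_j  (so that m_i = twoDegSum G i / deg G i)
twoDegSum : {n : ℕ} → Graph n → Fin n → ℕ
twoDegSum {n} G i = sumFin n (λ j → if adj G i j then deg G j else 0)

NoIsolated : {n : ℕ} → Graph n → Set
NoIsolated G = ∀ i → deg G i > 0

-- k-harmonic: m_i = k for all i, i.e. Σ_{j~i} d_j = k · d_i (d_i > 0)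
Harmonic : {n : ℕ} → ℕ → Graph n → Set
Harmonic k G = ∀ i → twoDegSum G i ≡ k * deg G i

Regular : {n : ℕ} → ℕ → Graph n → Set
Regular k G = ∀ i → deg G i ≡ k

-- pseudo k-regular graph (graphs have no isolated vertices by convention)
PseudoRegular : {n : ℕ} → ℕ → Graph n → Set
PseudoRegular k G = NoIsolated G × Harmonic k G × ¬ Regular k G

HasPseudoRegular : ℕ → ℕ → Set
HasPseudoRegular k n = Σ (Graph n) (λ G → PseudoRegular k G)

IsMinPseudoOrder : ℕ → ℕ → Set
IsMinPseudoOrder k N = HasPseudoRegular k N × (∀ m → HasPseudoRegular k m → N ≤ m)

-- If every degree of a k-harmonic graph is at most k, then Σ_{j ~ i} d_j = k d_i forces every
-- neighbour of every vertex to have degree k, so the graph is k-regular. Hence a pseudo k-regular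
-- graph has a vertex of degree > k and at least k + 2 vertices. On k + 2 and k + 3 vertices such a
-- vertex can be relabelled as vertex 0, adjacent to every other vertex except possibly the last,
-- and an exhaustive search over the remaining adjacencies finds no pseudo k-regular graph; so
-- N(3) ≥ 7 and N(4) ≥ 8. Conversely, explicit graphs cover 7 to 10 vertices for k = 3 and 8 to 12
-- for k = 4, and adding a disjoint copy of K_{k+1} keeps a graph pseudo k-regular, which reaches
-- every larger order.
module Submission where

open import Defs
open import Data.Bool using (Bool; true; false; if_then_else_; not; _∧_; _∨_)
open import Data.Bool.Properties using (∨-comm)
import Data.Bool.Properties as Bool
open import Data.Fin using (Fin; zero; suc; toℕ; inject₁; fromℕ; _↑ˡ_; _↑ʳ_; splitAt; join)
import Data.Fin.Properties as Fin
import Data.Fin.Permutation as Perm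
open import Data.Fin.Permutation using (Permutation; _⟨$⟩ʳ_; _⟨$⟩ˡ_; inverseʳ; transpose; lift₀)
open import Data.List using (List; []; _∷_)
open import Data.Bool.ListAction using (any)
open import Data.Nat using (ℕ; zero; suc; _+_; _*_; _≤_; _<_; z≤n; s≤s; NonZero; >-nonZero⁻¹; _≡ᵇ_; _≟_; _<?_; _≤?_)
open import Data.Nat.Properties
open import Algebra.Properties.Semiring.Sum +-*-semiring
  using (sum-cong-≗; sum-permute; sum-replicate-zero; *-distribˡ-sum)
open import Data.Product using (Σ-syntax; ∃; _×_; _,_)
open import Data.Sum using (_⊎_; inj₁; inj₂)
open import Data.Unit using (⊤; tt)
open import Data.Vec using (Vec; []; _∷_; lookup; tabulate)
open import Data.Vec.Properties using (lookup∘tabulate; tabulate-cong)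
open import Function using (_∘_)
open import Relation.Binary.PropositionalEquality
open import Relation.Nullary using (¬_; Dec; does; yes; no; ¬?; _×-dec_; contradiction)
open import Relation.Nullary.Decidable using (True; toWitness; map′; dec-true; decidable-stable)

count : ∀ {n} → (Fin n → Bool) → ℕ
count {n} f = sumFin n (λ j → if f j then 1 else 0)

sumFin-mono-≤ : ∀ n {f g : Fin n → ℕ} → (∀ j → f j ≤ g j) → sumFin n f ≤ sumFin n g
sumFin-mono-≤ zero    f≤g = z≤n
sumFin-mono-≤ (suc n) f≤g = +-mono-≤ (f≤g zero) (sumFin-mono-≤ n (f≤g ∘ suc))

sumFin-mono-≤-tight : ∀ n {f g : Fin n → ℕ} → (∀ j → f j ≤ g j) →
                      sumFin n g ≤ sumFin n f → ∀ j → f j ≡ g j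
sumFin-mono-≤-tight (suc n) {f} {g} f≤g Σg≤Σf zero = ≤-antisym (f≤g zero) g₀≤f₀
  where
  g₀≤f₀ : g zero ≤ f zero
  g₀≤f₀ = +-cancelʳ-≤ (sumFin n (g ∘ suc)) _ _
            (≤-trans Σg≤Σf (+-monoʳ-≤ (f zero) (sumFin-mono-≤ n (f≤g ∘ suc))))
sumFin-mono-≤-tight (suc n) {f} {g} f≤g Σg≤Σf (suc j) =
  sumFin-mono-≤-tight n (f≤g ∘ suc) (+-cancelˡ-≤ (g zero) _ _ (≤-trans Σg≤Σf (+-monoˡ-≤ _ (f≤g zero)))) j

sumFin-↑ : ∀ a b (f : Fin (a + b) → ℕ) →
           sumFin (a + b) f ≡ sumFin a (f ∘ (_↑ˡ b)) + sumFin b (f ∘ (a ↑ʳ_))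
sumFin-↑ zero    b f = refl
sumFin-↑ (suc a) b f = trans (cong (f zero +_) (sumFin-↑ a b (f ∘ suc))) (sym (+-assoc (f zero) _ _))

*-count : ∀ {n} k (f : Fin n → Bool) → k * count f ≡ sumFin n (λ j → if f j then k else 0)
*-count {n} k f = trans (*-distribˡ-sum {n} k _) (sum-cong-≗ (*-indicator ∘ f))
  where
  *-indicator : ∀ b → k * (if b then 1 else 0) ≡ (if b then k else 0)
  *-indicator true  = *-identityʳ k
  *-indicator false = *-zeroʳ k

count-true : ∀ n → count {n} (λ _ → true) ≡ n
count-true zero    = refl
count-true (suc n) = cong suc (count-true n)

count≤n : ∀ {n} (f : Fin n → Bool) → count f ≤ n
count≤n {zero}  f = z≤n
count≤n {suc n} f with f zero
... | true  = s≤s (count≤n (f ∘ suc))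
... | false = m≤n⇒m≤1+n (count≤n (f ∘ suc))

count<n : ∀ {n} (f : Fin n → Bool) i → f i ≡ false → count f < n
count<n f zero    f₀ rewrite f₀ = s≤s (count≤n (f ∘ suc))
count<n f (suc i) fᵢ with f zero
... | true  = s≤s (count<n (f ∘ suc) i fᵢ)
... | false = m<n⇒m<1+n (count<n (f ∘ suc) i fᵢ)

count>0 : ∀ {n} (f : Fin n → Bool) → 0 < count f → ∃ λ j → f j ≡ true
count>0 {suc n} f pos with f zero in f₀
... | true  = zero , f₀
... | false with count>0 (f ∘ suc) pos
...   | j , fⱼ = suc j , fⱼ

deg<n : ∀ {n} (G : Graph n) i → deg G i < n
deg<n G i = count<n (adj G i) i (loopless G i)

regular⇒harmonic : ∀ {n k} (G : Graph n) → Regular k G → Harmonic k G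
regular⇒harmonic {n} {k} G reg i =
  trans (sum-cong-≗ (λ j → cong (if adj G i j then_else 0) (reg j))) (sym (*-count k (adj G i)))

regular⇒noIsolated : ∀ {n k} .{{_ : NonZero k}} (G : Graph n) → Regular k G → NoIsolated G
regular⇒noIsolated {k = k} G reg i = subst (0 <_) (sym (reg i)) (>-nonZero⁻¹ k)

module _ {n k} (G : Graph n) (harmonic : Harmonic k G) (deg≤k : ∀ v → deg G v ≤ k) where

  neighbour-deg≡ : ∀ {i j} → adj G i j ≡ true → deg G j ≡ k
  neighbour-deg≡ {i} {j} i~j =
    subst (λ b → (if b then deg G j else 0) ≡ (if b then k else 0)) i~j
      (sumFin-mono-≤-tight n summand≤ (≤-reflexive (trans (sym (*-count k (adj G i))) (sym (harmonic i)))) j)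
    where
    summand≤ : ∀ j → (if adj G i j then deg G j else 0) ≤ (if adj G i j then k else 0)
    summand≤ j with adj G i j
    ... | true  = deg≤k j
    ... | false = z≤n

  harmonic-deg≤⇒regular : NoIsolated G → Regular k G
  harmonic-deg≤⇒regular noIsolated j with count>0 (adj G j) (noIsolated j)
  ... | i , j~i = neighbour-deg≡ (trans (symmetric G i j) j~i)

∃-deg> : ∀ {n k} (G : Graph n) → PseudoRegular k G → ∃ λ v → k < deg G v
∃-deg> {k = k} G (noIsolated , harmonic , ¬regular) with Fin.any? (λ v → k <? deg G v)
... | yes big = big
... | no ¬big =
  contradiction (harmonic-deg≤⇒regular G harmonic (λ v → ≮⇒≥ (¬big ∘ (v ,_))) noIsolated) ¬regular

pseudoRegular⇒2+k≤n : ∀ {n k} (G : Graph n) → PseudoRegular k G → 2 + k ≤ n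
pseudoRegular⇒2+k≤n G pr with ∃-deg> G pr
... | v , k<deg = ≤-trans (s≤s k<deg) (deg<n G v)

record _≅_ {n} (G H : Graph n) : Set where
  field
    σ     : Permutation n n
    adj-σ : ∀ i j → adj H i j ≡ adj G (σ ⟨$⟩ʳ i) (σ ⟨$⟩ʳ j)

module _ {n} {G H : Graph n} (G≅H : G ≅ H) where
  open _≅_ G≅H

  deg-≅ : ∀ i → deg H i ≡ deg G (σ ⟨$⟩ʳ i)
  deg-≅ i = trans (sum-cong-≗ (λ j → cong (if_then 1 else 0) (adj-σ i j)))
                  (sym (sum-permute (λ j → if adj G (σ ⟨$⟩ʳ i) j then 1 else 0) σ))

  twoDegSum-≅ : ∀ i → twoDegSum H i ≡ twoDegSum G (σ ⟨$⟩ʳ i)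
  twoDegSum-≅ i = trans (sum-cong-≗ (λ j → cong₂ (if_then_else 0) (adj-σ i j) (deg-≅ j)))
                        (sym (sum-permute (λ j → if adj G (σ ⟨$⟩ʳ i) j then deg G j else 0) σ))

  pseudoRegular-≅ : ∀ {k} → PseudoRegular k G → PseudoRegular k H
  pseudoRegular-≅ {k} (noIsolated , harmonic , ¬regular) =
    (λ i → subst (0 <_) (sym (deg-≅ i)) (noIsolated (σ ⟨$⟩ʳ i))) ,
    (λ i → trans (twoDegSum-≅ i) (trans (harmonic (σ ⟨$⟩ʳ i)) (cong (k *_) (sym (deg-≅ i))))) ,
    (λ regular → ¬regular λ i →
       trans (cong (deg G) (sym (inverseʳ σ))) (trans (sym (deg-≅ (σ ⟨$⟩ˡ i))) (regular (σ ⟨$⟩ˡ i))))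

relabel : ∀ {n} → Graph n → Permutation n n → Graph n
relabel G σ = record
  { adj       = λ i j → adj G (σ ⟨$⟩ʳ i) (σ ⟨$⟩ʳ j)
  ; symmetric = λ i j → symmetric G (σ ⟨$⟩ʳ i) (σ ⟨$⟩ʳ j)
  ; loopless  = λ i → loopless G (σ ⟨$⟩ʳ i)
  }

relabel-≅ : ∀ {n} (G : Graph n) σ → G ≅ relabel G σ
relabel-≅ G σ = record { σ = σ ; adj-σ = λ _ _ → refl }

adj⊎ : ∀ {a b} → Graph a → Graph b → Fin a ⊎ Fin b → Fin a ⊎ Fin b → Bool
adj⊎ G H (inj₁ i) (inj₁ j) = adj G i j
adj⊎ G H (inj₁ i) (inj₂ j) = false
adj⊎ G H (inj₂ i) (inj₁ j) = false
adj⊎ G H (inj₂ i) (inj₂ j) = adj H i j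

adj⊎-symmetric : ∀ {a b} (G : Graph a) (H : Graph b) x y → adj⊎ G H x y ≡ adj⊎ G H y x
adj⊎-symmetric G H (inj₁ i) (inj₁ j) = symmetric G i j
adj⊎-symmetric G H (inj₁ i) (inj₂ j) = refl
adj⊎-symmetric G H (inj₂ i) (inj₁ j) = refl
adj⊎-symmetric G H (inj₂ i) (inj₂ j) = symmetric H i j

adj⊎-loopless : ∀ {a b} (G : Graph a) (H : Graph b) x → adj⊎ G H x x ≡ false
adj⊎-loopless G H (inj₁ i) = loopless G i
adj⊎-loopless G H (inj₂ i) = loopless H i

_⊕_ : ∀ {a b} → Graph a → Graph b → Graph (a + b)
_⊕_ {a} G H = record
  { adj       = λ x y → adj⊎ G H (splitAt a x) (splitAt a y)
  ; symmetric = λ x y → adj⊎-symmetric G H (splitAt a x) (splitAt a y)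
  ; loopless  = λ x → adj⊎-loopless G H (splitAt a x)
  }

↑-elim : ∀ {a b} (P : Fin (a + b) → Set) → (∀ i → P (i ↑ˡ b)) → (∀ j → P (a ↑ʳ j)) → ∀ x → P x
↑-elim {a} {b} P left right x = subst P (Fin.join-splitAt a b x) (elim⊎ (splitAt a x))
  where
  elim⊎ : (y : Fin a ⊎ Fin b) → P (join a b y)
  elim⊎ (inj₁ i) = left i
  elim⊎ (inj₂ j) = right j

module _ {a b} (G : Graph a) (H : Graph b) where

  sum-adj-⊕ˡ : ∀ i (w : Fin (a + b) → ℕ) →
    sumFin (a + b) (λ y → if adj (G ⊕ H) (i ↑ˡ b) y then w y else 0) ≡
    sumFin a (λ j → if adj G i j then w (j ↑ˡ b) else 0)
  sum-adj-⊕ˡ i w = begin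
    sumFin (a + b) (λ y → if adj (G ⊕ H) (i ↑ˡ b) y then w y else 0)
      ≡⟨ sumFin-↑ a b _ ⟩
    sumFin a (λ j → if adj (G ⊕ H) (i ↑ˡ b) (j ↑ˡ b) then w (j ↑ˡ b) else 0) +
    sumFin b (λ j → if adj (G ⊕ H) (i ↑ˡ b) (a ↑ʳ j) then w (a ↑ʳ j) else 0)
      ≡⟨ cong₂ _+_ (sum-cong-≗ λ j → cong (if_then w (j ↑ˡ b) else 0)
                                          (cong₂ (adj⊎ G H) (Fin.splitAt-↑ˡ a i b) (Fin.splitAt-↑ˡ a j b)))
                   (trans (sum-cong-≗ λ j → cong (if_then w (a ↑ʳ j) else 0)
                                              (cong₂ (adj⊎ G H) (Fin.splitAt-↑ˡ a i b) (Fin.splitAt-↑ʳ a b j)))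
                          (sum-replicate-zero b)) ⟩
    sumFin a (λ j → if adj G i j then w (j ↑ˡ b) else 0) + 0
      ≡⟨ +-identityʳ _ ⟩
    sumFin a (λ j → if adj G i j then w (j ↑ˡ b) else 0) ∎
    where open ≡-Reasoning

  sum-adj-⊕ʳ : ∀ i (w : Fin (a + b) → ℕ) →
    sumFin (a + b) (λ y → if adj (G ⊕ H) (a ↑ʳ i) y then w y else 0) ≡
    sumFin b (λ j → if adj H i j then w (a ↑ʳ j) else 0)
  sum-adj-⊕ʳ i w = begin
    sumFin (a + b) (λ y → if adj (G ⊕ H) (a ↑ʳ i) y then w y else 0)
      ≡⟨ sumFin-↑ a b _ ⟩
    sumFin a (λ j → if adj (G ⊕ H) (a ↑ʳ i) (j ↑ˡ b) then w (j ↑ˡ b) else 0) +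
    sumFin b (λ j → if adj (G ⊕ H) (a ↑ʳ i) (a ↑ʳ j) then w (a ↑ʳ j) else 0)
      ≡⟨ cong₂ _+_ (trans (sum-cong-≗ λ j → cong (if_then w (j ↑ˡ b) else 0)
                                              (cong₂ (adj⊎ G H) (Fin.splitAt-↑ʳ a b i) (Fin.splitAt-↑ˡ a j b)))
                          (sum-replicate-zero a))
                   (sum-cong-≗ λ j → cong (if_then w (a ↑ʳ j) else 0)
                                          (cong₂ (adj⊎ G H) (Fin.splitAt-↑ʳ a b i) (Fin.splitAt-↑ʳ a b j))) ⟩
    sumFin b (λ j → if adj H i j then w (a ↑ʳ j) else 0) ∎
    where open ≡-Reasoning

  deg-⊕ˡ : ∀ i → deg (G ⊕ H) (i ↑ˡ b) ≡ deg G i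
  deg-⊕ˡ i = sum-adj-⊕ˡ i (λ _ → 1)

  deg-⊕ʳ : ∀ i → deg (G ⊕ H) (a ↑ʳ i) ≡ deg H i
  deg-⊕ʳ i = sum-adj-⊕ʳ i (λ _ → 1)

  twoDegSum-⊕ˡ : ∀ i → twoDegSum (G ⊕ H) (i ↑ˡ b) ≡ twoDegSum G i
  twoDegSum-⊕ˡ i = trans (sum-adj-⊕ˡ i (deg (G ⊕ H)))
                         (sum-cong-≗ λ j → cong (if adj G i j then_else 0) (deg-⊕ˡ j))

  twoDegSum-⊕ʳ : ∀ i → twoDegSum (G ⊕ H) (a ↑ʳ i) ≡ twoDegSum H i
  twoDegSum-⊕ʳ i = trans (sum-adj-⊕ʳ i (deg (G ⊕ H)))
                         (sum-cong-≗ λ j → cong (if adj H i j then_else 0) (deg-⊕ʳ j))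

  regular-⊕-pseudoRegular : ∀ {k} .{{_ : NonZero k}} →
                            Regular k G → PseudoRegular k H → PseudoRegular k (G ⊕ H)
  regular-⊕-pseudoRegular {k} regular (noIsolated , harmonic , ¬regular) =
    ↑-elim (λ x → 0 < deg (G ⊕ H) x)
      (λ i → subst (0 <_) (sym (deg-⊕ˡ i)) (regular⇒noIsolated G regular i))
      (λ j → subst (0 <_) (sym (deg-⊕ʳ j)) (noIsolated j)) ,
    ↑-elim (λ x → twoDegSum (G ⊕ H) x ≡ k * deg (G ⊕ H) x)
      (λ i → trans (twoDegSum-⊕ˡ i) (trans (regular⇒harmonic G regular i) (cong (k *_) (sym (deg-⊕ˡ i)))))
      (λ j → trans (twoDegSum-⊕ʳ j) (trans (harmonic j) (cong (k *_) (sym (deg-⊕ʳ j))))) ,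
    λ regular⊕ → ¬regular λ j → trans (sym (deg-⊕ʳ j)) (regular⊕ (a ↑ʳ j))

distinct : ∀ {n} → Fin n → Fin n → Bool
distinct i j = not (does (i Fin.≟ j))

distinct-sym : ∀ {n} (i j : Fin n) → distinct i j ≡ distinct j i
distinct-sym i j with i Fin.≟ j | j Fin.≟ i
... | yes _   | yes _   = refl
... | no _    | no _    = refl
... | yes i≡j | no j≢i  = contradiction (sym i≡j) j≢i
... | no i≢j  | yes j≡i = contradiction (sym j≡i) i≢j

distinct-irrefl : ∀ {n} (i : Fin n) → distinct i i ≡ false
distinct-irrefl i = cong not (dec-true (i Fin.≟ i) refl)

complete : ∀ n → Graph n
complete n = record { adj = distinct ; symmetric = distinct-sym ; loopless = distinct-irrefl }

complete-regular : ∀ n → Regular n (complete (suc n))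
complete-regular zero    zero    = refl
complete-regular (suc n) zero    = cong suc (count-true n)
complete-regular (suc n) (suc i) = cong suc (complete-regular n i)

joins : ∀ {n} → Fin n → Fin n → ℕ × ℕ → Bool
joins i j (u , v) = ((toℕ i ≡ᵇ u) ∧ (toℕ j ≡ᵇ v)) ∨ ((toℕ j ≡ᵇ u) ∧ (toℕ i ≡ᵇ v))

any-joins-sym : ∀ {n} (i j : Fin n) es → any (joins i j) es ≡ any (joins j i) es
any-joins-sym i j []             = refl
any-joins-sym i j ((u , v) ∷ es) =
  cong₂ _∨_ (∨-comm ((toℕ i ≡ᵇ u) ∧ (toℕ j ≡ᵇ v)) _) (any-joins-sym i j es)

-- Pairs mentioning a vertex ≥ n, or of the form (u , u), contribute no edge.
fromEdges : ∀ {n} → List (ℕ × ℕ) → Graph n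
fromEdges es = record
  { adj       = λ i j → distinct i j ∧ any (joins i j) es
  ; symmetric = λ i j → cong₂ _∧_ (distinct-sym i j) (any-joins-sym i j es)
  ; loopless  = λ i → cong (_∧ any (joins i i) es) (distinct-irrefl i)
  }

noIsolated? : ∀ {n} (G : Graph n) → Dec (NoIsolated G)
noIsolated? G = Fin.all? (λ i → 0 <? deg G i)

harmonic? : ∀ {n} k (G : Graph n) → Dec (Harmonic k G)
harmonic? k G = Fin.all? (λ i → twoDegSum G i ≟ k * deg G i)

regular? : ∀ {n} k (G : Graph n) → Dec (Regular k G)
regular? k G = Fin.all? (λ i → deg G i ≟ k)

pseudoRegular? : ∀ {n} k (G : Graph n) → Dec (PseudoRegular k G)
-- Harmonicity is tested first since it fails fastest; this keeps the exhaustive searches cheap.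
pseudoRegular? k G =
  map′ (λ (h , i , r) → i , h , r) (λ (i , h , r) → h , i , r)
       (harmonic? k G ×-dec noIsolated? G ×-dec ¬? (regular? k G))

certified : ∀ {n} k (G : Graph n) → {True (pseudoRegular? k G)} → HasPseudoRegular k n
certified k G {pr} = G , toWitness pr

addComplete : ∀ {k n} .{{_ : NonZero k}} → HasPseudoRegular k n → HasPseudoRegular k (suc k + n)
addComplete {k} (G , pr) = complete (suc k) ⊕ G , regular-⊕-pseudoRegular _ G (complete-regular k) pr

pseudoRegular₃ : ∀ r → HasPseudoRegular 3 (7 + r)
pseudoRegular₃ 0 = certified 3 (fromEdges
  ((0 , 1) ∷ (0 , 2) ∷ (0 , 3) ∷ (0 , 4) ∷ (1 , 2) ∷ (1 , 5) ∷ (2 , 5) ∷ (3 , 4) ∷ (3 , 6) ∷ (4 , 6) ∷ []))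
pseudoRegular₃ 1 = certified 3 (fromEdges
  ((0 , 1) ∷ (0 , 2) ∷ (0 , 3) ∷ (0 , 4) ∷ (1 , 2) ∷ (1 , 3) ∷ (1 , 5) ∷ (2 , 6) ∷ (3 , 7) ∷ (4 , 5) ∷ []))
pseudoRegular₃ 2 = certified 3 (fromEdges
  ((0 , 1) ∷ (0 , 2) ∷ (0 , 3) ∷ (0 , 4) ∷ (1 , 2) ∷ (1 , 5) ∷ (1 , 6) ∷ (2 , 7) ∷ (2 , 8) ∷ (3 , 4) ∷
   (5 , 6) ∷ (7 , 8) ∷ []))
pseudoRegular₃ 3 = certified 3 (fromEdges
  ((0 , 2) ∷ (0 , 3) ∷ (0 , 8) ∷ (0 , 9) ∷ (1 , 3) ∷ (1 , 5) ∷ (2 , 4) ∷ (2 , 5) ∷ (2 , 6) ∷ (3 , 5) ∷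
   (4 , 8) ∷ (6 , 7) ∷ (6 , 9) ∷ (7 , 9) ∷ []))
pseudoRegular₃ (suc (suc (suc (suc r)))) = addComplete (pseudoRegular₃ r)

pseudoRegular₄ : ∀ r → HasPseudoRegular 4 (8 + r)
pseudoRegular₄ 0 = certified 4 (fromEdges
  ((0 , 1) ∷ (0 , 2) ∷ (0 , 3) ∷ (0 , 4) ∷ (0 , 5) ∷ (1 , 2) ∷ (1 , 3) ∷ (1 , 4) ∷ (1 , 6) ∷ (2 , 3) ∷
   (2 , 7) ∷ (3 , 7) ∷ (4 , 5) ∷ (4 , 6) ∷ (5 , 6) ∷ []))
pseudoRegular₄ 1 = certified 4 (fromEdges
  ((0 , 1) ∷ (0 , 2) ∷ (0 , 3) ∷ (0 , 4) ∷ (0 , 6) ∷ (1 , 2) ∷ (1 , 3) ∷ (1 , 5) ∷ (1 , 7) ∷ (2 , 4) ∷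
   (2 , 8) ∷ (3 , 5) ∷ (3 , 8) ∷ (4 , 5) ∷ (4 , 6) ∷ (5 , 7) ∷ (6 , 7) ∷ []))
pseudoRegular₄ 2 = certified 4 (fromEdges
  ((0 , 1) ∷ (0 , 2) ∷ (0 , 3) ∷ (0 , 4) ∷ (0 , 5) ∷ (0 , 6) ∷ (1 , 2) ∷ (1 , 3) ∷ (1 , 7) ∷ (2 , 3) ∷
   (2 , 7) ∷ (3 , 8) ∷ (4 , 5) ∷ (4 , 6) ∷ (4 , 8) ∷ (5 , 6) ∷ (5 , 9) ∷ (6 , 9) ∷ []))
pseudoRegular₄ 3 = certified 4 (fromEdges
  ((0 , 3) ∷ (0 , 4) ∷ (0 , 6) ∷ (0 , 10) ∷ (1 , 4) ∷ (1 , 6) ∷ (1 , 7) ∷ (1 , 8) ∷ (2 , 4) ∷ (2 , 5) ∷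
   (2 , 6) ∷ (2 , 7) ∷ (3 , 8) ∷ (4 , 5) ∷ (4 , 8) ∷ (4 , 10) ∷ (5 , 6) ∷ (5 , 9) ∷ (8 , 10) ∷ (9 , 10) ∷ []))
pseudoRegular₄ 4 = certified 4 (fromEdges
  ((0 , 1) ∷ (0 , 6) ∷ (1 , 2) ∷ (1 , 7) ∷ (1 , 10) ∷ (2 , 4) ∷ (2 , 5) ∷ (2 , 6) ∷ (2 , 9) ∷ (2 , 11) ∷
   (3 , 4) ∷ (3 , 9) ∷ (4 , 5) ∷ (4 , 6) ∷ (5 , 8) ∷ (5 , 9) ∷ (6 , 7) ∷ (7 , 10) ∷ (7 , 11) ∷ (8 , 11) ∷
   (9 , 10) ∷ (10 , 11) ∷ []))
pseudoRegular₄ (suc (suc (suc (suc (suc r))))) = addComplete (pseudoRegular₄ r)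

-- Row i of the upper triangle records adjacency of vertex i to the vertices after it.
Triangle : ℕ → Set
Triangle zero    = ⊤
Triangle (suc n) = Vec Bool n × Triangle n

triangleAdj : ∀ {n} → Triangle n → Fin n → Fin n → Bool
triangleAdj (r , t) zero    zero    = false
triangleAdj (r , t) zero    (suc j) = lookup r j
triangleAdj (r , t) (suc i) zero    = lookup r i
triangleAdj (r , t) (suc i) (suc j) = triangleAdj t i j

triangleAdj-symmetric : ∀ {n} (t : Triangle n) i j → triangleAdj t i j ≡ triangleAdj t j i
triangleAdj-symmetric (r , t) zero    zero    = refl
triangleAdj-symmetric (r , t) zero    (suc j) = refl
triangleAdj-symmetric (r , t) (suc i) zero    = refl
triangleAdj-symmetric (r , t) (suc i) (suc j) = triangleAdj-symmetric t i j

triangleAdj-loopless : ∀ {n} (t : Triangle n) i → triangleAdj t i i ≡ false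
triangleAdj-loopless (r , t) zero    = refl
triangleAdj-loopless (r , t) (suc i) = triangleAdj-loopless t i

graphOf : ∀ {n} → Triangle n → Graph n
graphOf t = record
  { adj = triangleAdj t ; symmetric = triangleAdj-symmetric t ; loopless = triangleAdj-loopless t }

row : ∀ {n} → Graph (suc n) → Vec Bool n
row G = tabulate (adj G zero ∘ suc)

tail : ∀ {n} → Graph (suc n) → Graph n
tail G = record
  { adj       = λ i j → adj G (suc i) (suc j)
  ; symmetric = λ i j → symmetric G (suc i) (suc j)
  ; loopless  = λ i → loopless G (suc i)
  }

triangleOf : ∀ {n} → Graph n → Triangle n
triangleOf {zero}  G = tt
triangleOf {suc n} G = row G , triangleOf (tail G)

triangleAdj-triangleOf : ∀ {n} (G : Graph n) i j → triangleAdj (triangleOf G) i j ≡ adj G i j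
triangleAdj-triangleOf G zero    zero    = sym (loopless G zero)
triangleAdj-triangleOf G zero    (suc j) = lookup∘tabulate _ j
triangleAdj-triangleOf G (suc i) zero    = trans (lookup∘tabulate _ i) (symmetric G zero (suc i))
triangleAdj-triangleOf G (suc i) (suc j) = triangleAdj-triangleOf (tail G) i j

graphOf-triangleOf-≅ : ∀ {n} (G : Graph n) → G ≅ graphOf (triangleOf G)
graphOf-triangleOf-≅ G = record { σ = Perm.id ; adj-σ = triangleAdj-triangleOf G }

anyVec : ∀ {n} → (Vec Bool n → Bool) → Bool
anyVec {zero}  p = p []
anyVec {suc n} p = anyVec (p ∘ (true ∷_)) ∨ anyVec (p ∘ (false ∷_))

anyVec-complete : ∀ {n} (p : Vec Bool n → Bool) v → p v ≡ true → anyVec p ≡ true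
anyVec-complete p []          pv = pv
anyVec-complete p (true ∷ v)  pv =
  cong (_∨ anyVec (p ∘ (false ∷_))) (anyVec-complete (p ∘ (true ∷_)) v pv)
anyVec-complete p (false ∷ v) pv =
  trans (cong (anyVec (p ∘ (true ∷_)) ∨_) (anyVec-complete (p ∘ (false ∷_)) v pv)) (Bool.∨-zeroʳ _)

search-refutes : ∀ {A : Set} {b : Bool} → (A → b ≡ true) → b ≡ false → ¬ A
search-refutes complete b≡false a with trans (sym (complete a)) b≡false
... | ()

anyVec-refutes : ∀ {n} {P : Vec Bool n → Set} (P? : ∀ v → Dec (P v)) →
                 anyVec (does ∘ P?) ≡ false → ∀ v → ¬ P v
anyVec-refutes P? none v = search-refutes (λ pv → anyVec-complete (does ∘ P?) v (dec-true (P? v) pv)) none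

anyTriangle : ∀ {n} → (Triangle n → Bool) → Bool
anyTriangle {zero}  p = p tt
anyTriangle {suc n} p = anyVec (λ r → anyTriangle (λ t → p (r , t)))

anyTriangle-complete : ∀ {n} (p : Triangle n → Bool) t → p t ≡ true → anyTriangle p ≡ true
anyTriangle-complete {zero}  p tt      pt = pt
anyTriangle-complete {suc n} p (r , t) pt =
  anyVec-complete _ r (anyTriangle-complete (λ t → p (r , t)) t pt)

FullExceptLast : ∀ {m} → Vec Bool (suc m) → Set
FullExceptLast {m} r = ∀ (j : Fin m) → lookup r (inject₁ j) ≡ true

fullExceptLast? : ∀ {m} (r : Vec Bool (suc m)) → Dec (FullExceptLast r)
fullExceptLast? r = Fin.all? (λ j → lookup r (inject₁ j) Bool.≟ true)

firstFalse : ∀ {m} → Vec Bool (suc m) → Fin (suc m)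
firstFalse (false ∷ _)     = zero
firstFalse (true ∷ [])     = zero
firstFalse (true ∷ b ∷ r)  = suc (firstFalse (b ∷ r))

falseToEnd : ∀ {m} → Vec Bool (suc m) → Permutation (suc m) (suc m)
falseToEnd {m} r = transpose (firstFalse r) (fromℕ m)

permute : ∀ {n} → Vec Bool n → Permutation n n → Vec Bool n
permute r σ = tabulate (lookup r ∘ (σ ⟨$⟩ʳ_))

FalseToEndNormalises : ℕ → Set
FalseToEndNormalises m =
  ∀ (r : Vec Bool (suc m)) → m ≤ count (lookup r) → FullExceptLast (permute r (falseToEnd r))

falseToEndFails? : ∀ {m} (r : Vec Bool (suc m)) →
                   Dec (m ≤ count (lookup r) × ¬ FullExceptLast (permute r (falseToEnd r)))
falseToEndFails? {m} r = (m ≤? count (lookup r)) ×-dec ¬? (fullExceptLast? (permute r (falseToEnd r)))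

falseToEndNormalises : ∀ m → anyVec (does ∘ falseToEndFails? {m}) ≡ false → FalseToEndNormalises m
falseToEndNormalises m noFailure r m≤count =
  decidable-stable (fullExceptLast? (permute r (falseToEnd r)))
    (λ ¬full → anyVec-refutes falseToEndFails? noFailure r (m≤count , ¬full))

NormalForm : ℕ → ℕ → Set
NormalForm k m =
  Σ[ r ∈ Vec Bool (suc m) ] FullExceptLast r × Σ[ t ∈ Triangle (suc m) ] PseudoRegular k (graphOf (r , t))

normalFormRow : ∀ k {m} → Vec Bool (suc m) → Bool
normalFormRow k r = does (fullExceptLast? r) ∧ anyTriangle (λ t → does (pseudoRegular? k (graphOf (r , t))))

normalFormSearch : ℕ → ℕ → Bool
normalFormSearch k m = anyVec (normalFormRow k {m})

normalFormSearch-complete : ∀ {k m} → NormalForm k m → normalFormSearch k m ≡ true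
normalFormSearch-complete {k} {m} (r , full , t , pr) =
  anyVec-complete (normalFormRow k {m}) r
    (cong₂ _∧_ (dec-true (fullExceptLast? r) full)
               (anyTriangle-complete (λ t → does (pseudoRegular? k (graphOf (r , t)))) t
                                     (dec-true (pseudoRegular? k (graphOf (r , t))) pr)))

deg-row : ∀ {m} (G : Graph (suc m)) → deg G zero ≡ count (lookup (row G))
deg-row {m} G rewrite loopless G zero =
  sum-cong-≗ {m} (λ j → cong (if_then 1 else 0) (sym (lookup∘tabulate (adj G zero ∘ suc) j)))

row-relabel-lift₀ : ∀ {m} (G : Graph (suc m)) (τ : Permutation m m) →
                    row (relabel G (lift₀ τ)) ≡ permute (row G) τ
row-relabel-lift₀ G τ = tabulate-cong (λ j → sym (lookup∘tabulate _ (τ ⟨$⟩ʳ j)))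

normalise : ∀ {k m} → m ≤ suc k → FalseToEndNormalises m →
            (G : Graph (2 + m)) → PseudoRegular k G → NormalForm k m
normalise {k} {m} m≤1+k normalises G pr with ∃-deg> G pr
... | v , k<deg =
  row G₂ , fullExceptLast , triangleOf (tail G₂) , pseudoRegular-≅ (graphOf-triangleOf-≅ G₂) pr₂
  where
  G₁ : Graph (2 + m)
  G₁ = relabel G (transpose zero v)

  m≤count : m ≤ count (lookup (row G₁))
  m≤count = ≤-trans m≤1+k (≤-trans k<deg (≤-reflexive
              (trans (sym (deg-≅ (relabel-≅ G (transpose zero v)) zero)) (deg-row G₁))))

  τ : Permutation (suc m) (suc m)
  τ = falseToEnd (row G₁)

  G₂ : Graph (2 + m)
  G₂ = relabel G₁ (lift₀ τ)

  pr₂ : PseudoRegular k G₂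
  pr₂ = pseudoRegular-≅ (relabel-≅ G₁ (lift₀ τ)) (pseudoRegular-≅ (relabel-≅ G (transpose zero v)) pr)

  fullExceptLast : FullExceptLast (row G₂)
  fullExceptLast = subst FullExceptLast (sym (row-relabel-lift₀ G₁ τ)) (normalises (row G₁) m≤count)

noPseudoRegular : ∀ k m → m ≤ suc k → anyVec (does ∘ falseToEndFails? {m}) ≡ false →
                  normalFormSearch k m ≡ false → ¬ HasPseudoRegular k (2 + m)
noPseudoRegular k m m≤1+k noFailure noNormalForm (G , pr) =
  search-refutes normalFormSearch-complete noNormalForm
    (normalise m≤1+k (falseToEndNormalises m noFailure) G pr)

order≥4+k : ∀ {k n} → ¬ HasPseudoRegular k (2 + k) → ¬ HasPseudoRegular k (3 + k) →
            HasPseudoRegular k n → 4 + k ≤ n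
order≥4+k none₂ none₃ (G , pr) with m≤n⇒m<n∨m≡n (pseudoRegular⇒2+k≤n G pr)
... | inj₂ refl = contradiction (G , pr) none₂
... | inj₁ 3+k≤n with m≤n⇒m<n∨m≡n 3+k≤n
...   | inj₂ refl  = contradiction (G , pr) none₃
...   | inj₁ 4+k≤n = 4+k≤n

order≥7 : ∀ {n} → HasPseudoRegular 3 n → 7 ≤ n
order≥7 = order≥4+k (noPseudoRegular 3 3 (n≤1+n 3) refl refl) (noPseudoRegular 3 4 ≤-refl refl refl)

order≥8 : ∀ {n} → HasPseudoRegular 4 n → 8 ≤ n
order≥8 = order≥4+k (noPseudoRegular 4 4 (n≤1+n 4) refl refl) (noPseudoRegular 4 5 ≤-refl refl refl)

corollary5p2 : (k : ℕ) → (k ≡ 3 ⊎ k ≡ 4) → (N : ℕ) → IsMinPseudoOrder k N →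
    (n : ℕ) → N ≤ n → HasPseudoRegular k n
corollary5p2 _ (inj₁ refl) N (pseudo₃ , _) n N≤n with m≤n⇒∃[o]m+o≡n (≤-trans (order≥7 pseudo₃) N≤n)
... | o , refl = pseudoRegular₃ o
corollary5p2 _ (inj₂ refl) N (pseudo₄ , _) n N≤n with m≤n⇒∃[o]m+o≡n (≤-trans (order≥8 pseudo₄) N≤n)
... | o , refl = pseudoRegular₄ o
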